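{- For every $n\ge1$ and every permutation $\pi\in\mathfrak S_n$, $\psi(\pi)=\varepsilon(f(\pi))$.
   Context: $\mathfrak S_n$ is the symmetric group on $[n]$ in one-line notation; $\mathfrak S_0=\{\emptyset\}$. For $n\ge1$, $Y_n$ is the set of planar binary trees with $n$ internal nodes ($n+1$ leaves ordered left to right); $Y_0=\{\ast\}$, the trivial one-vertex tree. For $T_1\in Y_p,T_2\in Y_q$, $T_1\vee T_2\in Y_{p+q+1}$ is the tree with a new root having left subtree $T_1$ and right subtree $T_2$. For a word $a$ of distinct integers, $\mathrm{std}(a)$ is its standardization (smallest letter becomes 1, next 2, etc.; $\mathrm{std}(\emptyset)=\emptyset$). Loday–Ronco map $\psi:\mathfrak S_n\to Y_n$: $\psi(\emptyset)=\ast$; for $n>0$ write $\pi=\pi_L\,n\,\pi_R$ (the subwords to the left and right of the entry $n$), and set $\psi(\pi)=\psi(\mathrm{std}(\pi_L))\vee\psi(\mathrm{std}(\pi_R))$. Indexed terms: $\mathcal L^I$ is generated by symbols $\mathbf 2^k$ ($k$ a positive integer) of arity $2$, and for terms $\mathbf A,\mathbf B$ and $1\le m\le|\mathbf A|$ the term $\mathbf A\circ_m\mathbf B$ of arity $|\mathbf A|+|\mathbf B|-1$; no index occurs twice in a term. The evaluation $\varepsilon$ forgets indices, sends $\mathbf 2^k$ to the 2-corolla and $\mathbf A\circ_m\mathbf B$ to the tree obtained by grafting the root of $\varepsilon(\mathbf B)$ onto the $m$-th leaf of $\varepsilon(\mathbf A)$. Decreasing encoding: for a nonempty word $a=a_1\cdots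 a_r$ of distinct positive integers, let $\kappa_1>\kappa_2>\cdots>\kappa_r$ be its letters in decreasing order, and for a letter $x$ of $a$ let $u_a(x)$ be the number of letters of $a$ to the left of $x$ that are greater than $x$. Then $f(a)=\mathbf 2^{\kappa_1}$ if $r=1$, and otherwise $f(a)=(\cdots((\mathbf 2^{\kappa_1}\circ_{m_2}\mathbf 2^{\kappa_2})\circ_{m_3}\mathbf 2^{\kappa_3})\cdots)\circ_{m_r}\mathbf 2^{\kappa_r}$ with $m_q=u_a(\kappa_q)+1$. -}

module Defs where

open import Data.Nat using (ℕ; zero; suc; _+_; _∸_; _<?_; _≤?_; _≟_)
open import Data.List using (List; []; _∷_; length; map; foldl)
open import Data.Product using (_×_; _,_)
open import Data.Maybe using (Maybe; just; nothing)
open import Relation.Nullary using (yes; no)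

-- Planar binary trees.  Y_n = trees with n internal nodes.
-- `leaf` is the trivial one-vertex tree ∗, `node T₁ T₂` is T₁ ∨ T₂.

data Tree : Set where
  leaf : Tree
  node : Tree → Tree → Tree

_∨_ : Tree → Tree → Tree
_∨_ = node

internalNodes : Tree → ℕ
internalNodes leaf       = 0
internalNodes (node l r) = suc (internalNodes l + internalNodes r)

leaves : Tree → ℕ
leaves leaf       = 1
leaves (node l r) = leaves l + leaves r

-- Words: finite lists of natural numbers (one-line notation).

countLess : ℕ → List ℕ → ℕ
countLess x []       = 0
countLess x (y ∷ ys) with y <? x
... | yes _ = suc (countLess x ys)
... | no  _ = countLess x ys

std : List ℕ → List ℕ
std a = map (λ x → suc (countLess x a)) a

splitAround : ℕ → List ℕ → List ℕ × List ℕ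
splitAround x []       = [] , []
splitAround x (y ∷ ys) with y ≟ x
... | yes _ = [] , ys
... | no  _ with splitAround x ys
...   | (l , r) = (y ∷ l) , r

-- For π ∈ 𝔖_n (n = length π) we split π = π_L n π_R.
-- The recursion is on a fuel argument, which is ≥ the length of the
-- word; ψ π uses fuel = length π, which is always sufficient.

ψF : ℕ → List ℕ → Tree
ψF zero    _       = leaf
ψF (suc k) []      = leaf
ψF (suc k) (x ∷ xs) with splitAround (length (x ∷ xs)) (x ∷ xs)
... | (πL , πR) = ψF k (std πL) ∨ ψF k (std πR)

ψ : List ℕ → Tree
ψ π = ψF (length π) π

-- Indexed terms (raw syntax) and their evaluation ε.
-- `two k` is 𝟐^k, `A ∘[ m ] B` is A ∘_m B.

data Term : Set where
  two   : ℕ → Term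
  _∘[_]_ : Term → ℕ → Term → Term

arity : Term → ℕ
arity (two _)      = 2
arity (A ∘[ m ] B) = arity A + arity B ∸ 1

-- graft the root of B onto the m-th leaf (1-indexed, left to right) of T
graft : Tree → ℕ → Tree → Tree
graft leaf       1 B = B
graft leaf       _ B = leaf
graft (node l r) m B with m ≤? leaves l
... | yes _ = node (graft l m B) r
... | no  _ = node l (graft r (m ∸ leaves l) B)

corolla₂ : Tree
corolla₂ = node leaf leaf

ε : Term → Tree
ε (two _)      = corolla₂
ε (A ∘[ m ] B) = graft (ε A) m (ε B)

insertDesc : ℕ → List ℕ → List ℕ
insertDesc x []       = x ∷ []
insertDesc x (y ∷ ys) with y <? x
... | yes _ = x ∷ y ∷ ys
... | no  _ = y ∷ insertDesc x ys

sortDesc : List ℕ → List ℕ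
sortDesc []       = []
sortDesc (x ∷ xs) = insertDesc x (sortDesc xs)

countGreater : ℕ → List ℕ → ℕ
countGreater x []       = 0
countGreater x (y ∷ ys) with x <? y
... | yes _ = suc (countGreater x ys)
... | no  _ = countGreater x ys

u : List ℕ → ℕ → ℕ
u a x with splitAround x a
... | (l , _) = countGreater x l

-- f(a) for nonempty a; f [] = nothing (f is undefined on the empty word)
f : List ℕ → Maybe Term
f a with sortDesc a
... | []      = nothing
... | κ₁ ∷ κs = just (foldl (λ t κ → t ∘[ suc (u a κ) ] two κ) (two κ₁) κs)

-- Both sides are the shape of the decreasing binary tree of π: its root is the largest letter m
-- and, writing π = l m r, its subtrees are the decreasing trees of l and r. That shape is unique,
-- so it suffices that each side has it. For ψ this is its defining recursion, up to
-- standardization, which is strictly increasing on the letters of a word and so does not change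
-- the shape. For f, build the tree of the letters ≥ j for j = n, n-1, ..., 1: the new letter j is
-- smaller than all letters present, so it enters as a 2-corolla grafted onto a leaf, namely onto
-- leaf u_π(j) + 1, because exactly u_π(j) of the letters present stand to its left in π.
module Submission where

open import Defs
open import Level using (0ℓ)
open import Data.Nat using (ℕ; zero; suc; _+_; _≤_; _<_; z≤n; s≤s; _<?_; _≤?_; _≟_)
open import Data.Nat.Properties
  using (≤-refl; ≤-trans; ≤-antisym; ≤-reflexive; ≤-pred; <-irrefl; <-trans; <-asym;
         <-≤-trans; <⇒≤; <⇒≢; ≮⇒≥; ≤∧≢⇒<; ≤⇒≯; <-cmp; m≤m+n; m≤n+m; m≤n⇒m≤1+n; n≤1+n;
         +-suc; m+n∸m≡n; m+1+n≰m; ≤-totalOrder)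
open import Data.List
  using (List; []; _∷_; _++_; length; map; filter; foldl; reverse; upTo; downFrom; applyDownFrom)
open import Data.List.Properties
  using (++-assoc; length-++; length-map; ∷-injective; ++-conicalʳ; filter-++; filter-accept;
         filter-reject; filter-none; filter-all; reverse-map; reverse-upTo; map-downFrom;
         length-applyDownFrom)
open import Data.List.Membership.Propositional using (_∈_; _∉_)
open import Data.List.Membership.Propositional.Properties using (∈-++⁺ˡ; ∈-++⁺ʳ; ∈-map⁺)
open import Data.List.Relation.Unary.Any using (here; there)
open import Data.List.Relation.Unary.All as All using (All; []; _∷_)
open import Data.List.Relation.Unary.All.Properties as All
  using (all-filter; applyDownFrom⁺₁; applyDownFrom⁺₂)
open import Data.List.Relation.Unary.Linked using ([]; [-]; _∷_)
open import Data.List.Relation.Unary.Unique.Propositional as Unique using (Unique; []; _∷_)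
open import Data.List.Relation.Unary.Unique.Propositional.Properties
  using (Unique[x∷xs]⇒x∉xs) renaming (applyDownFrom⁺₁ to Unique-applyDownFrom⁺₁)
open import Data.List.Relation.Unary.Sorted.TotalOrder.Properties
  using (↗↭↗⇒≋) renaming (applyDownFrom⁺₂ to Sorted-applyDownFrom⁺₂)
open import Data.List.Relation.Binary.Subset.Propositional using (_⊆_)
open import Data.List.Relation.Binary.Pointwise using (Pointwise-≡⇒≡)
open import Data.List.Relation.Binary.Permutation.Propositional
  using (_↭_; ↭-refl; ↭-sym; ↭-trans; ↭-reflexive; ↭-prep; ↭-swap; ↭⇒↭ₛ)
open import Data.List.Relation.Binary.Permutation.Propositional.Properties
  using (∈-resp-↭; All-resp-↭; ↭-length; ↭-reverse)
open import Data.List.Extrema.Nat using (max; xs≤max; v≤max⁺; argmax-sel)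
open import Data.Maybe using (just) renaming (map to mapMaybe)
open import Data.Product using (∃-syntax; _×_; _,_; proj₁; proj₂)
open import Data.Sum using (_⊎_; inj₁; inj₂)
open import Data.Empty using (⊥-elim)
open import Function using (_∘_)
open import Relation.Nullary using (yes; no)
open import Relation.Binary.Bundles using (TotalOrder)
open import Relation.Binary.Definitions using (tri<; tri≈; tri>)
import Relation.Binary.Construct.Flip.EqAndOrd as Flip
open import Relation.Binary.PropositionalEquality
  using (_≡_; _≢_; refl; sym; trans; cong; cong₂; subst; subst₂; ≢-sym; setoid; module ≡-Reasoning)
open import Data.List.Relation.Binary.Permutation.Setoid.Properties (setoid ℕ) using (Unique-resp-↭)

module _ {A : Set} where

  ++-∷-≡-++⁻ : ∀ (l : List A) {m} r xs ys → l ++ m ∷ r ≡ xs ++ ys →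
    (∃[ c ] xs ≡ l ++ m ∷ c × r ≡ c ++ ys) ⊎ (∃[ c ] l ≡ xs ++ c × ys ≡ c ++ m ∷ r)
  ++-∷-≡-++⁻ l r [] ys e = inj₂ (l , refl , sym e)
  ++-∷-≡-++⁻ [] r (x ∷ xs) ys e with ∷-injective e
  ... | refl , r≡ = inj₁ (xs , refl , r≡)
  ++-∷-≡-++⁻ (y ∷ l) r (x ∷ xs) ys e with ∷-injective e
  ... | refl , e′ with ++-∷-≡-++⁻ l r xs ys e′
  ...   | inj₁ (c , refl , r≡) = inj₁ (c , refl , r≡)
  ...   | inj₂ (c , refl , ys≡) = inj₂ (c , refl , ys≡)

  map-≡-++-∷⁻ : ∀ {B : Set} (g : A → B) l {m} r w → l ++ m ∷ r ≡ map g w →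
    ∃[ l₀ ] ∃[ m₀ ] ∃[ r₀ ] w ≡ l₀ ++ m₀ ∷ r₀ × l ≡ map g l₀ × m ≡ g m₀ × r ≡ map g r₀
  map-≡-++-∷⁻ g [] r (x ∷ w) e with ∷-injective e
  ... | refl , refl = [] , x , w , refl , refl , refl , refl
  map-≡-++-∷⁻ g (y ∷ l) r (x ∷ w) e with ∷-injective e
  ... | refl , e′ with map-≡-++-∷⁻ g l r w e′
  ...   | l₀ , m₀ , r₀ , refl , refl , refl , refl = x ∷ l₀ , m₀ , r₀ , refl , refl , refl , refl

  Unique-++⁻ˡ : ∀ xs {ys} → Unique {A = A} (xs ++ ys) → Unique xs
  Unique-++⁻ˡ []       _         = []
  Unique-++⁻ˡ (x ∷ xs) (x∉ ∷ u) = All.++⁻ˡ xs x∉ ∷ Unique-++⁻ˡ xs u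

  Unique-++⁻ʳ : ∀ xs {ys} → Unique {A = A} (xs ++ ys) → Unique ys
  Unique-++⁻ʳ []       u        = u
  Unique-++⁻ʳ (x ∷ xs) (_ ∷ u) = Unique-++⁻ʳ xs u

  Unique-++-∷⇒∉ˡ : ∀ xs {x ys} → Unique {A = A} (xs ++ x ∷ ys) → x ∉ xs
  Unique-++-∷⇒∉ˡ (y ∷ xs) (y≢ ∷ _) (here refl) = All.lookup y≢ (∈-++⁺ʳ xs (here refl)) refl
  Unique-++-∷⇒∉ˡ (y ∷ xs) (_ ∷ u)  (there x∈) = Unique-++-∷⇒∉ˡ xs u x∈

  Unique-++-∷⇒∉ʳ : ∀ xs {x ys} → Unique {A = A} (xs ++ x ∷ ys) → x ∉ ys
  Unique-++-∷⇒∉ʳ xs u = Unique[x∷xs]⇒x∉xs (Unique-++⁻ʳ xs u)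

All-≤-∉⇒All-< : ∀ {n w} → n ∉ w → All (_≤ n) w → All (_< n) w
All-≤-∉⇒All-< n∉ []          = []
All-≤-∉⇒All-< n∉ (x≤n ∷ xs≤n) =
  ≤∧≢⇒< x≤n (λ x≡n → n∉ (here (sym x≡n))) ∷ All-≤-∉⇒All-< (n∉ ∘ there) xs≤n

splitAround-++ : ∀ {x w} → x ∈ w → w ≡ proj₁ (splitAround x w) ++ x ∷ proj₂ (splitAround x w)
splitAround-++ {x} {y ∷ w} x∈ with y ≟ x
splitAround-++ {x} {y ∷ w} x∈          | yes y≡x = cong (_∷ w) y≡x
splitAround-++ {x} {y ∷ w} (here x≡y)  | no y≢x  = ⊥-elim (y≢x (sym x≡y))
splitAround-++ {x} {y ∷ w} (there x∈) | no _    = cong (y ∷_) (splitAround-++ x∈)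

data DecTree : List ℕ → Tree → Set where
  leaf : DecTree [] leaf
  node : ∀ {l m r tl tr} → All (_< m) l → All (_< m) r → DecTree l tl → DecTree r tr →
         DecTree (l ++ m ∷ r) (node tl tr)

max-split-unique : ∀ l {m r} l′ {m′ r′} → l ++ m ∷ r ≡ l′ ++ m′ ∷ r′ →
  All (_< m) l → All (_< m) r → All (_< m′) l′ → All (_< m′) r′ → l ≡ l′ × r ≡ r′
max-split-unique [] [] e _ _ _ _ = refl , proj₂ (∷-injective e)
max-split-unique [] (y ∷ l′) e _ r<m (y<m′ ∷ _) _ with ∷-injective e
... | refl , refl = ⊥-elim (<-asym y<m′ (All.lookup r<m (∈-++⁺ʳ l′ (here refl))))
max-split-unique (y ∷ l) [] e (y<m ∷ _) _ _ r′<m′ with ∷-injective e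
... | refl , refl = ⊥-elim (<-asym y<m (All.lookup r′<m′ (∈-++⁺ʳ l (here refl))))
max-split-unique (y ∷ l) (y′ ∷ l′) e (_ ∷ l<m) r<m (_ ∷ l′<m′) r′<m′ with ∷-injective e
... | refl , e′ with max-split-unique l l′ e′ l<m r<m l′<m′ r′<m′
...   | refl , r≡r′ = refl , r≡r′

DecTree-functional : ∀ {w t t′} → DecTree w t → DecTree w t′ → t ≡ t′
DecTree-functional d d′ = go d d′ refl
  where
  go : ∀ {w w′ t t′} → DecTree w t → DecTree w′ t′ → w ≡ w′ → t ≡ t′
  go leaf leaf _ = refl
  go leaf (node {l} _ _ _ _) e with () ← ++-conicalʳ l _ (sym e)
  go (node {l} _ _ _ _) leaf e with () ← ++-conicalʳ l _ e
  go (node {l} l<m r<m dl dr) (node {l′} l′<m′ r′<m′ dl′ dr′) e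
    with max-split-unique l l′ e l<m r<m l′<m′ r′<m′
  ... | refl , refl = cong₂ node (go dl dl′ refl) (go dr dr′ refl)

leaves-DecTree : ∀ {w t} → DecTree w t → leaves t ≡ suc (length w)
leaves-DecTree leaf = refl
leaves-DecTree (node {l} {m} {r} _ _ dl dr)
  rewrite leaves-DecTree dl | leaves-DecTree dr | length-++ l {m ∷ r} = refl

graft-node-≤ : ∀ {i} l r B → i ≤ leaves l → graft (node l r) i B ≡ node (graft l i B) r
graft-node-≤ {i} l r B i≤ with i ≤? leaves l
... | yes _ = refl
... | no i≰ = ⊥-elim (i≰ i≤)

graft-node-+ : ∀ l r i B → graft (node l r) (leaves l + suc i) B ≡ node l (graft r (suc i) B)
graft-node-+ l r i B with leaves l + suc i ≤? leaves l
... | yes ≤l = ⊥-elim (m+1+n≰m (leaves l) ≤l)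
... | no _ = cong (λ j → node l (graft r j B)) (m+n∸m≡n (leaves l) (suc i))

DecTree-insert-min : ∀ {w t} → DecTree w t → ∀ xs ys {x} → w ≡ xs ++ ys →
  All (x <_) xs → All (x <_) ys → DecTree (xs ++ x ∷ ys) (graft t (suc (length xs)) corolla₂)
DecTree-insert-min leaf [] [] _ _ _ = node [] [] leaf leaf
DecTree-insert-min (node {l} {m} {r} {tl} {tr} l<m r<m dl dr) xs ys {x} e x<xs x<ys
  with ++-∷-≡-++⁻ l r xs ys e
... | inj₁ (c , refl , refl) =
  subst₂ DecTree (sym (++-assoc l (m ∷ c) (x ∷ ys))) (sym grafted)
    (node l<m (All.++⁺ (All.++⁻ˡ c r<m) (x<m ∷ All.++⁻ʳ c r<m)) dl
      (DecTree-insert-min dr c ys refl (All.tail (All.++⁻ʳ l x<xs)) x<ys))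
  where
  x<m : x < m
  x<m = All.lookup x<xs (∈-++⁺ʳ l (here refl))
  grafted : graft (node tl tr) (suc (length (l ++ m ∷ c))) corolla₂
          ≡ node tl (graft tr (suc (length c)) corolla₂)
  grafted = trans (cong (λ i → graft (node tl tr) i corolla₂) position)
                  (graft-node-+ tl tr (length c) corolla₂)
    where
    position : suc (length (l ++ m ∷ c)) ≡ leaves tl + suc (length c)
    position = trans (cong suc (length-++ l)) (cong (_+ suc (length c)) (sym (leaves-DecTree dl)))
... | inj₂ (c , refl , refl) =
  subst₂ DecTree (++-assoc xs (x ∷ c) (m ∷ r)) (sym grafted)
    (node (All.++⁺ (All.++⁻ˡ xs l<m) (x<m ∷ All.++⁻ʳ xs l<m)) r<m
      (DecTree-insert-min dl xs c refl x<xs (All.++⁻ˡ c x<ys)) dr)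
  where
  x<m : x < m
  x<m = All.lookup x<ys (∈-++⁺ʳ c (here refl))
  grafted : graft (node tl tr) (suc (length xs)) corolla₂
          ≡ node (graft tl (suc (length xs)) corolla₂) tr
  grafted = graft-node-≤ tl tr corolla₂
    (subst (suc (length xs) ≤_) (sym (trans (leaves-DecTree dl) (cong suc (length-++ xs))))
      (s≤s (m≤m+n (length xs) (length c))))

StrictlyIncreasingOn : (ℕ → ℕ) → List ℕ → Set
StrictlyIncreasingOn g w = ∀ {x y} → x ∈ w → y ∈ w → x < y → g x < g y

module _ {g w} (g↑ : StrictlyIncreasingOn g w) where

  StrictlyIncreasingOn-⊆ : ∀ {w′} → w′ ⊆ w → StrictlyIncreasingOn g w′
  StrictlyIncreasingOn-⊆ w′⊆w x∈ y∈ = g↑ (w′⊆w x∈) (w′⊆w y∈)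

  StrictlyIncreasingOn⇒reflects-< : ∀ {x y} → x ∈ w → y ∈ w → g x < g y → x < y
  StrictlyIncreasingOn⇒reflects-< {x} {y} x∈ y∈ gx<gy with <-cmp x y
  ... | tri< x<y _ _ = x<y
  ... | tri≈ _ refl _ = ⊥-elim (<-irrefl refl gx<gy)
  ... | tri> _ _ y<x = ⊥-elim (<-asym gx<gy (g↑ y∈ x∈ y<x))

  StrictlyIncreasingOn⇒preserves-≢ : ∀ {x y} → x ∈ w → y ∈ w → x ≢ y → g x ≢ g y
  StrictlyIncreasingOn⇒preserves-≢ {x} {y} x∈ y∈ x≢y with <-cmp x y
  ... | tri< x<y _ _ = <⇒≢ (g↑ x∈ y∈ x<y)
  ... | tri≈ _ x≡y _ = ⊥-elim (x≢y x≡y)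
  ... | tri> _ _ y<x = ≢-sym (<⇒≢ (g↑ y∈ x∈ y<x))

Unique-map⁺ : ∀ {g w} → StrictlyIncreasingOn g w → Unique w → Unique (map g w)
Unique-map⁺ {w = []}    _  []        = []
Unique-map⁺ {w = x ∷ w} g↑ (x≢ ∷ u) =
  All.map⁺ (All.tabulate λ y∈ →
    StrictlyIncreasingOn⇒preserves-≢ g↑ (here refl) (there y∈) (All.lookup x≢ y∈))
  ∷ Unique-map⁺ (StrictlyIncreasingOn-⊆ g↑ there) u

DecTree-map⁻ : ∀ {g w t} → StrictlyIncreasingOn g w → DecTree (map g w) t → DecTree w t
DecTree-map⁻ g↑ d = go d _ refl g↑
  where
  go : ∀ {v t} → DecTree v t → ∀ w {g} → v ≡ map g w → StrictlyIncreasingOn g w → DecTree w t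
  go leaf [] _ _ = leaf
  go (node {l} {m} {r} l<m r<m dl dr) w {g} e g↑ with map-≡-++-∷⁻ g l r w e
  ... | l₀ , m₀ , r₀ , refl , refl , refl , refl =
    node (below l₀ (∈-++⁺ˡ) l<m) (below r₀ (∈-++⁺ʳ l₀ ∘ there) r<m)
      (go dl l₀ refl (StrictlyIncreasingOn-⊆ g↑ ∈-++⁺ˡ))
      (go dr r₀ refl (StrictlyIncreasingOn-⊆ g↑ (∈-++⁺ʳ l₀ ∘ there)))
    where
    below : ∀ xs → xs ⊆ l₀ ++ m₀ ∷ r₀ → All (_< g m₀) (map g xs) → All (_< m₀) xs
    below xs xs⊆ gxs<gm = All.tabulate λ x∈ →
      StrictlyIncreasingOn⇒reflects-< g↑ (xs⊆ x∈) (∈-++⁺ʳ l₀ (here refl))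
        (All.lookup (All.map⁻ gxs<gm) x∈)

countLess-mono-≤ : ∀ w {x y} → x ≤ y → countLess x w ≤ countLess y w
countLess-mono-≤ [] _ = z≤n
countLess-mono-≤ (z ∷ w) {x} {y} x≤y with z <? x | z <? y
... | yes _   | yes _   = s≤s (countLess-mono-≤ w x≤y)
... | yes z<x | no z≮y  = ⊥-elim (z≮y (<-≤-trans z<x x≤y))
... | no _    | yes _   = m≤n⇒m≤1+n (countLess-mono-≤ w x≤y)
... | no _    | no _    = countLess-mono-≤ w x≤y

countLess-mono-< : ∀ w {x y} → x ∈ w → x < y → countLess x w < countLess y w
countLess-mono-< (z ∷ w) {x} {y} x∈ x<y with z <? x | z <? y
countLess-mono-< (z ∷ w) x∈          x<y | yes z<x | no z≮y = ⊥-elim (z≮y (<-trans z<x x<y))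
countLess-mono-< (z ∷ w) (here refl) x<y | yes z<z | _      = ⊥-elim (<-irrefl refl z<z)
countLess-mono-< (z ∷ w) (there x∈)  x<y | yes _   | yes _  = s≤s (countLess-mono-< w x∈ x<y)
countLess-mono-< (z ∷ w) x∈          x<y | no _    | yes _  = s≤s (countLess-mono-≤ w (<⇒≤ x<y))
countLess-mono-< (z ∷ w) (here refl) x<y | no _    | no z≮y = ⊥-elim (z≮y x<y)
countLess-mono-< (z ∷ w) (there x∈)  x<y | no _    | no _   = countLess-mono-< w x∈ x<y

countLess-≤-length : ∀ x w → countLess x w ≤ length w
countLess-≤-length x [] = z≤n
countLess-≤-length x (z ∷ w) with z <? x
... | yes _ = s≤s (countLess-≤-length x w)
... | no  _ = m≤n⇒m≤1+n (countLess-≤-length x w)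

countLess-<-length : ∀ {x w} → x ∈ w → countLess x w < length w
countLess-<-length {x} {z ∷ w} x∈ with z <? x
countLess-<-length (here refl) | yes z<z = ⊥-elim (<-irrefl refl z<z)
countLess-<-length (there x∈)  | yes _   = s≤s (countLess-<-length x∈)
countLess-<-length {x} {z ∷ w} _ | no _  = s≤s (countLess-≤-length x w)

countLess-all : ∀ {x w} → All (_< x) w → countLess x w ≡ length w
countLess-all [] = refl
countLess-all {x} {z ∷ w} (z<x ∷ w<x) with z <? x
... | yes _   = cong suc (countLess-all w<x)
... | no z≮x = ⊥-elim (z≮x z<x)

countLess-max : ∀ {x w} → x ∈ w → All (_≤ x) w → Unique w → suc (countLess x w) ≡ length w
countLess-max {x} {z ∷ w} _ _ _ with z <? x
countLess-max (here refl) _ _ | yes z<z = ⊥-elim (<-irrefl refl z<z)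
countLess-max (there x∈)  (_ ∷ w≤x) (_ ∷ u) | yes _ = cong suc (countLess-max x∈ w≤x u)
countLess-max {x} {z ∷ w} _ (z≤x ∷ w≤x) u | no z≮x with ≤-antisym z≤x (≮⇒≥ z≮x)
... | refl = cong suc (countLess-all (All-≤-∉⇒All-< (Unique[x∷xs]⇒x∉xs u) w≤x))

length-++-∷-≤ : ∀ {A : Set} (l : List A) {x} r {k} →
  length (l ++ x ∷ r) ≤ suc k → length l ≤ k × length r ≤ k
length-++-∷-≤ l r {k} len≤ = ≤-trans (m≤m+n _ _) l+r≤k , ≤-trans (m≤n+m _ _) l+r≤k
  where
  l+r≤k : length l + length r ≤ k
  l+r≤k = ≤-pred (subst (_≤ suc k) (trans (length-++ l) (+-suc (length l) (length r))) len≤)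

std-increasing : ∀ w → StrictlyIncreasingOn (λ x → suc (countLess x w)) w
std-increasing w x∈ _ x<y = s≤s (countLess-mono-< w x∈ x<y)

std-bounded : ∀ w → All (_≤ length w) (std w)
std-bounded w = All.map⁺ (All.tabulate countLess-<-length)

length∈std : ∀ {x w} → Unique (x ∷ w) → length (x ∷ w) ∈ std (x ∷ w)
length∈std {x} {w} u =
  subst (_∈ std (x ∷ w)) (countLess-max top∈ (x≤top ∷ xs≤max x w) u) (∈-map⁺ _ top∈)
  where
  x≤top : x ≤ max x w
  x≤top = v≤max⁺ x w (inj₁ ≤-refl)
  top∈ : max x w ∈ x ∷ w
  top∈ with argmax-sel (λ y → y) x w
  ... | inj₁ top≡x = here top≡x
  ... | inj₂ top∈w = there top∈w

mutual
  ψF-DecTree : ∀ k s {n} → length s ≡ n → n ≤ k → Unique s → All (_≤ n) s → n ∈ s →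
    DecTree s (ψF k s)
  ψF-DecTree (suc k) (x ∷ s) refl len≤ u s≤n n∈s =
    subst (λ w → DecTree w (ψF (suc k) (x ∷ s))) (sym split)
      (node (All-≤-∉⇒All-< (Unique-++-∷⇒∉ˡ l u′) (All.++⁻ˡ l s≤n′))
            (All-≤-∉⇒All-< (Unique-++-∷⇒∉ʳ l u′) (All.tail (All.++⁻ʳ l s≤n′)))
            (std-DecTree k l (proj₁ lengths≤) (Unique-++⁻ˡ l u′))
            (std-DecTree k r (proj₂ lengths≤) (Unique.tail (Unique-++⁻ʳ l u′))))
    where
    n = length (x ∷ s)
    l = proj₁ (splitAround n (x ∷ s))
    r = proj₂ (splitAround n (x ∷ s))
    split : x ∷ s ≡ l ++ n ∷ r
    split = splitAround-++ n∈s
    u′ : Unique (l ++ n ∷ r)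
    u′ = subst Unique split u
    s≤n′ : All (_≤ n) (l ++ n ∷ r)
    s≤n′ = subst (All (_≤ n)) split s≤n
    lengths≤ : length l ≤ k × length r ≤ k
    lengths≤ = length-++-∷-≤ l r (subst (λ w → length w ≤ suc k) split len≤)

  std-DecTree : ∀ k w → length w ≤ k → Unique w → DecTree w (ψF k (std w))
  std-DecTree zero    [] _ _ = leaf
  std-DecTree (suc k) [] _ _ = leaf
  std-DecTree k (x ∷ w) len≤ u =
    DecTree-map⁻ (std-increasing (x ∷ w))
      (ψF-DecTree k (std (x ∷ w)) (length-map _ (x ∷ w)) len≤
        (Unique-map⁺ (std-increasing (x ∷ w)) u) (std-bounded (x ∷ w)) (length∈std u))

atLeast : ℕ → List ℕ → List ℕ
atLeast j = filter (j ≤?_)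

countGreater≡length-atLeast : ∀ x w → countGreater x w ≡ length (atLeast (suc x) w)
countGreater≡length-atLeast x [] = refl
countGreater≡length-atLeast x (y ∷ w) with x <? y
... | yes x<y = trans (cong suc (countGreater≡length-atLeast x w))
                     (cong length (sym (filter-accept (suc x ≤?_) x<y)))
... | no  x≮y = trans (countGreater≡length-atLeast x w)
                     (cong length (sym (filter-reject (suc x ≤?_) x≮y)))

atLeast-suc : ∀ {j w} → j ∉ w → atLeast j w ≡ atLeast (suc j) w
atLeast-suc {j} {[]} _ = refl
atLeast-suc {j} {y ∷ w} j∉ with j ≤? y
... | yes j≤y = begin
  atLeast j (y ∷ w)          ≡⟨ filter-accept (j ≤?_) j≤y ⟩
  y ∷ atLeast j w            ≡⟨ cong (y ∷_) (atLeast-suc (j∉ ∘ there)) ⟩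
  y ∷ atLeast (suc j) w      ≡⟨ filter-accept (suc j ≤?_) j<y ⟨
  atLeast (suc j) (y ∷ w)    ∎
  where
  open ≡-Reasoning
  j<y : j < y
  j<y = ≤∧≢⇒< j≤y (λ j≡y → j∉ (here j≡y))
... | no j≰y = begin
  atLeast j (y ∷ w)          ≡⟨ filter-reject (j ≤?_) j≰y ⟩
  atLeast j w                ≡⟨ atLeast-suc (j∉ ∘ there) ⟩
  atLeast (suc j) w          ≡⟨ filter-reject (suc j ≤?_) (j≰y ∘ <⇒≤) ⟨
  atLeast (suc j) (y ∷ w)    ∎
  where open ≡-Reasoning

atLeast-insert : ∀ {π j t} → Unique π → j ∈ π → DecTree (atLeast (suc j) π) t →
  DecTree (atLeast j π) (graft t (suc (u π j)) corolla₂)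
atLeast-insert {π} {j} {t} uπ j∈ d =
  subst₂ DecTree (sym atLeast-j)
    (cong (λ i → graft t (suc i) corolla₂) (sym (countGreater≡length-atLeast j l)))
    (DecTree-insert-min d (atLeast (suc j) l) (atLeast (suc j) r) atLeast-suc-j
      (all-filter (suc j ≤?_) l) (all-filter (suc j ≤?_) r))
  where
  open ≡-Reasoning
  l = proj₁ (splitAround j π)
  r = proj₂ (splitAround j π)
  split : π ≡ l ++ j ∷ r
  split = splitAround-++ j∈
  u′ : Unique (l ++ j ∷ r)
  u′ = subst Unique split uπ
  atLeast-j : atLeast j π ≡ atLeast (suc j) l ++ j ∷ atLeast (suc j) r
  atLeast-j = begin
    atLeast j π
      ≡⟨ cong (atLeast j) split ⟩
    atLeast j (l ++ j ∷ r)
      ≡⟨ filter-++ (j ≤?_) l (j ∷ r) ⟩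
    atLeast j l ++ atLeast j (j ∷ r)
      ≡⟨ cong (atLeast j l ++_) (filter-accept (j ≤?_) ≤-refl) ⟩
    atLeast j l ++ j ∷ atLeast j r
      ≡⟨ cong₂ (λ a b → a ++ j ∷ b) (atLeast-suc (Unique-++-∷⇒∉ˡ l u′))
                                    (atLeast-suc (Unique-++-∷⇒∉ʳ l u′)) ⟩
    atLeast (suc j) l ++ j ∷ atLeast (suc j) r
      ∎
  atLeast-suc-j : atLeast (suc j) π ≡ atLeast (suc j) l ++ atLeast (suc j) r
  atLeast-suc-j = begin
    atLeast (suc j) π
      ≡⟨ cong (atLeast (suc j)) split ⟩
    atLeast (suc j) (l ++ j ∷ r)
      ≡⟨ filter-++ (suc j ≤?_) l (j ∷ r) ⟩
    atLeast (suc j) l ++ atLeast (suc j) (j ∷ r)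
      ≡⟨ cong (atLeast (suc j) l ++_) (filter-reject (suc j ≤?_) (<-irrefl refl)) ⟩
    atLeast (suc j) l ++ atLeast (suc j) r
      ∎

u-max≡0 : ∀ {a x} → x ∈ a → All (_≤ x) a → u a x ≡ 0
u-max≡0 {a} {x} x∈ a≤x =
  trans (countGreater≡length-atLeast x l) (cong length (filter-none (suc x ≤?_) (All.map ≤⇒≯ l≤x)))
  where
  l = proj₁ (splitAround x a)
  l≤x : All (_≤ x) l
  l≤x = All.++⁻ˡ l (subst (All (_≤ x)) (splitAround-++ x∈) a≤x)

encodeStep : List ℕ → Term → ℕ → Term
encodeStep a t κ = t ∘[ suc (u a κ) ] two κ

foldl-encodeStep-DecTree : ∀ {π} → Unique π → ∀ m {t} → All (_∈ π) (applyDownFrom suc m) →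
  DecTree (atLeast (suc m) π) (ε t) →
  DecTree (atLeast 1 π) (ε (foldl (encodeStep π) t (applyDownFrom suc m)))
foldl-encodeStep-DecTree uπ zero    _           d = d
foldl-encodeStep-DecTree uπ (suc m) (m∈ ∷ ms∈) d =
  foldl-encodeStep-DecTree uπ m ms∈ (atLeast-insert uπ m∈ d)

f≡foldl-encodeStep : ∀ a {κ κs} → sortDesc a ≡ κ ∷ κs →
  f a ≡ just (foldl (encodeStep a) (two κ) κs)
f≡foldl-encodeStep a e rewrite e = refl

≥-totalOrder : TotalOrder 0ℓ 0ℓ 0ℓ
≥-totalOrder = Flip.totalOrder ≤-totalOrder

open import Data.List.Relation.Unary.Sorted.TotalOrder ≥-totalOrder using (Sorted)

insertDesc-↭ : ∀ x xs → insertDesc x xs ↭ x ∷ xs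
insertDesc-↭ x [] = ↭-refl
insertDesc-↭ x (y ∷ ys) with y <? x
... | yes _ = ↭-refl
... | no  _ = ↭-trans (↭-prep y (insertDesc-↭ x ys)) (↭-swap y x ↭-refl)

sortDesc-↭ : ∀ xs → sortDesc xs ↭ xs
sortDesc-↭ [] = ↭-refl
sortDesc-↭ (x ∷ xs) = ↭-trans (insertDesc-↭ x (sortDesc xs)) (↭-prep x (sortDesc-↭ xs))

insertDesc-sorted : ∀ x {xs} → Sorted xs → Sorted (insertDesc x xs)
insertDesc-sorted x [] = [-]
insertDesc-sorted x {y ∷ ys} ys↘ with y <? x
... | yes y<x = <⇒≤ y<x ∷ ys↘
insertDesc-sorted x {y ∷ []} [-] | no y≮x = ≮⇒≥ y≮x ∷ [-]
insertDesc-sorted x {y ∷ z ∷ ys} (z≤y ∷ ys↘) | no y≮x with z <? x | insertDesc-sorted x ys↘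
... | yes _ | ins↘ = ≮⇒≥ y≮x ∷ ins↘
... | no  _ | ins↘ = z≤y ∷ ins↘

sortDesc-sorted : ∀ xs → Sorted (sortDesc xs)
sortDesc-sorted [] = []
sortDesc-sorted (x ∷ xs) = insertDesc-sorted x (sortDesc-sorted xs)

sortDesc-↭-sorted : ∀ {xs ys} → xs ↭ ys → Sorted ys → sortDesc xs ≡ ys
sortDesc-↭-sorted {xs} xs↭ys ys↘ =
  Pointwise-≡⇒≡ (↗↭↗⇒≋ ≥-totalOrder (sortDesc-sorted xs) ys↘
    (↭⇒↭ₛ (↭-trans (sortDesc-↭ xs) xs↭ys)))

map-suc-upTo-↭ : ∀ n → map suc (upTo n) ↭ applyDownFrom suc n
map-suc-upTo-↭ n = ↭-trans (↭-sym (↭-reverse (map suc (upTo n)))) (↭-reflexive (begin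
  reverse (map suc (upTo n))   ≡⟨ reverse-map suc (upTo n) ⟨
  map suc (reverse (upTo n))   ≡⟨ cong (map suc) (reverse-upTo n) ⟩
  map suc (downFrom n)         ≡⟨ map-downFrom suc n ⟩
  applyDownFrom suc n          ∎))
  where open ≡-Reasoning

module _ {n π} (desc↭π : applyDownFrom suc n ↭ π) where

  rearrangement-unique : Unique π
  rearrangement-unique = Unique-resp-↭ (↭⇒↭ₛ desc↭π)
    (Unique-applyDownFrom⁺₁ suc n (λ j<i _ → ≢-sym (<⇒≢ (s≤s j<i))))

  rearrangement-bounded : All (_≤ n) π
  rearrangement-bounded = All-resp-↭ desc↭π (applyDownFrom⁺₁ suc n (λ i<n → i<n))

  rearrangement-positive : All (1 ≤_) π
  rearrangement-positive = All-resp-↭ desc↭π (applyDownFrom⁺₂ suc n (λ _ → s≤s z≤n))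

  rearrangement-complete : All (_∈ π) (applyDownFrom suc n)
  rearrangement-complete = All.tabulate (∈-resp-↭ desc↭π)

  rearrangement-length : length π ≡ n
  rearrangement-length = trans (sym (↭-length desc↭π)) (length-applyDownFrom suc n)

ψ-DecTree : ∀ {n π} → applyDownFrom suc (suc n) ↭ π → DecTree π (ψ π)
ψ-DecTree {n} {π} desc↭π =
  ψF-DecTree (length π) π length≡ (≤-reflexive (sym length≡))
    (rearrangement-unique desc↭π) (rearrangement-bounded desc↭π)
    (All.head (rearrangement-complete desc↭π))
  where
  length≡ : length π ≡ suc n
  length≡ = rearrangement-length desc↭π

encoding-DecTree : ∀ {n π} → applyDownFrom suc (suc n) ↭ π →
  DecTree π (ε (foldl (encodeStep π) (two (suc n)) (applyDownFrom suc n)))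
encoding-DecTree {n} {π} desc↭π =
  subst (λ w → DecTree w (ε (foldl (encodeStep π) (two (suc n)) (applyDownFrom suc n))))
    (filter-all (1 ≤?_) (rearrangement-positive desc↭π))
    (foldl-encodeStep-DecTree uπ n (All.tail (rearrangement-complete desc↭π)) top)
  where
  uπ = rearrangement-unique desc↭π
  π≤N = rearrangement-bounded desc↭π
  N∈π = All.head (rearrangement-complete desc↭π)
  nothing-above-N : DecTree (atLeast (suc (suc n)) π) leaf
  nothing-above-N =
    subst (λ w → DecTree w leaf) (sym (filter-none (suc (suc n) ≤?_) (All.map ≤⇒≯ π≤N))) leaf
  -- ε (two N) is graft leaf 1 corolla₂: the first letter of the encoding is an insertion step too.
  top : DecTree (atLeast (suc n) π) (ε (two (suc n)))
  top = subst (λ i → DecTree (atLeast (suc n) π) (graft leaf (suc i) corolla₂))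
    (u-max≡0 N∈π π≤N) (atLeast-insert uπ N∈π nothing-above-N)

theorem4p13 : (n : ℕ) → 1 ≤ n → (π : List ℕ) → π ↭ map suc (upTo n) →
    mapMaybe ε (f π) ≡ just (ψ π)
theorem4p13 zero    () _ _
theorem4p13 (suc n) _  π π↭ = begin
  mapMaybe ε (f π)
    ≡⟨ cong (mapMaybe ε) (f≡foldl-encodeStep π sorted) ⟩
  just (ε (foldl (encodeStep π) (two (suc n)) (applyDownFrom suc n)))
    ≡⟨ cong just (DecTree-functional (encoding-DecTree desc↭π) (ψ-DecTree desc↭π)) ⟩
  just (ψ π)
    ∎
  where
  open ≡-Reasoning
  desc↭π : applyDownFrom suc (suc n) ↭ π
  desc↭π = ↭-sym (↭-trans π↭ (map-suc-upTo-↭ (suc n)))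
  sorted : sortDesc π ≡ applyDownFrom suc (suc n)
  sorted = sortDesc-↭-sorted (↭-sym desc↭π)
    (Sorted-applyDownFrom⁺₂ ≥-totalOrder suc (suc n) (λ i → n≤1+n (suc i)))
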